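{- Let $Q'$ be a spanning subgraph of the hypercube $Q=Q^d$. Suppose that (a) every vertex has a neighbour in $Q$ which is $Q'$-good, and (b) for every pair $u,v$ of $Q'$-good vertices at distance at most $3$ in $Q$ there is a $u$–$v$ path in $Q'$. Then for every pair $u,v$ of $Q'$-good vertices there is a $u$–$v$ path in $Q'$; hence all $Q'$-good vertices lie in the same component of $Q'$.
   Context: $Q^d$ is the hypercube on $\{0,1\}^d$. A parameter $p\in(0,\tfrac12)$ is fixed; for a spanning subgraph $Q'$ of $Q^d$, a vertex is $Q'$-good if its degree in $Q'$ is at least $dp/2$.
   Formalization: The fixed parameter p ranges over the rational numbers strictly between 0 and 1/2. -}

module Defs where

open import Data.Bool using (Bool; true; false; not; if_then_else_)
open import Data.Nat using (ℕ; zero; suc; _+_; _*_)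
open import Data.Fin using (Fin; zero; suc; _≟_)
open import Data.Integer using (+_)
open import Data.Rational using (ℚ; _/_; _≤_) renaming (_*_ to _*ℚ_)
open import Data.Product using (Σ; _×_; _,_)
open import Relation.Nullary using (does)
open import Relation.Binary.PropositionalEquality using (_≡_)

Vertex : ℕ → Set
Vertex d = Fin d → Bool

flip : ∀ {d} → Vertex d → Fin d → Vertex d
flip x i j = if does (i ≟ j) then not (x j) else x j

countTrue : ∀ {d} → (Fin d → Bool) → ℕ
countTrue {zero} f = 0
countTrue {suc d} f = (if f zero then 1 else 0) + countTrue (λ j → f (suc j))

-- Hamming distance = graph distance in Q^d.
dist : ∀ {d} → Vertex d → Vertex d → ℕ
dist x y = countTrue (λ j → not (does (Data.Bool._≟_ (x j) (y j))))
  where import Data.Bool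

-- A spanning subgraph Q' of Q^d: every edge of Q^d is {x, flip x i};
-- keep x i says whether this edge is in Q'.  Well-definedness on the
-- undirected edge is required as a symmetry condition.
record Subgraph (d : ℕ) : Set where
  field
    keep : Vertex d → Fin d → Bool
    sym  : ∀ x i → keep x i ≡ keep (flip x i) i
open Subgraph public

degree : ∀ {d} → Subgraph d → Vertex d → ℕ
degree Q' x = countTrue (keep Q' x)

-- x is Q'-good iff deg_{Q'}(x) ≥ d p / 2, i.e. d·p ≤ 2·deg.
Good : ∀ {d} → ℚ → Subgraph d → Vertex d → Set
Good {d} p Q' x = ((+ d / 1) *ℚ p) ≤ (+ (2 * degree Q' x) / 1)

-- A u–v walk in Q' (existence of a walk = existence of a path).
data Path {d} (Q' : Subgraph d) : Vertex d → Vertex d → Set where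
  here : ∀ {u} → Path Q' u u
  step : ∀ {u v} (i : Fin d) → keep Q' u i ≡ true → Path Q' (flip u i) v → Path Q' u v

-- Follow a shortest u–v path x₀ = u, x₁, …, xₙ = v in Q and attach to every xₖ a good
-- vertex gₖ within distance 1 (g₀ = u, and any good neighbour of xₖ for k ≥ 1).
-- Consecutive gₖ, gₖ₊₁ are at distance at most 1 + 1 + 1 = 3, so (b) joins them in Q';
-- since gₙ is within distance 1 of v, (b) also joins gₙ to v.
module Submission where

open import Defs hiding (sym)
open import Data.Nat using (ℕ; zero; suc; _+_; _≤_; z≤n; s≤s)
open import Data.Nat.Properties
  using (≤-refl; ≤-reflexive; ≤-trans; +-mono-≤; +-monoʳ-≤; +-identityʳ; suc-injective; +-commutativeSemigroup; module ≤-Reasoning)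
open import Algebra.Properties.CommutativeSemigroup +-commutativeSemigroup using (interchange)
open import Data.Fin using (Fin; zero; suc; _≟_)
open import Data.Bool using (Bool; true; false; not; if_then_else_)
import Data.Bool as Bool
open import Data.Rational using (ℚ; 0ℚ; ½; _<_)
open import Data.Product using (Σ; _,_; _×_)
open import Relation.Nullary using (does; yes; no)
open import Relation.Binary.PropositionalEquality using (_≡_; refl; sym; trans; cong; cong₂)
open import Data.Empty using (⊥-elim)

indicator : Bool → ℕ
indicator b = if b then 1 else 0

countTrue-cong : ∀ {d} {f g : Fin d → Bool} → (∀ j → f j ≡ g j) → countTrue f ≡ countTrue g
countTrue-cong {zero} f≗g = refl
countTrue-cong {suc d} f≗g = cong₂ (λ a m → indicator a + m) (f≗g zero) (countTrue-cong (λ j → f≗g (suc j)))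

countTrue-false : ∀ {d} {f : Fin d → Bool} → (∀ j → f j ≡ false) → countTrue f ≡ 0
countTrue-false {zero} f≗false = refl
countTrue-false {suc d} f≗false rewrite f≗false zero = countTrue-false (λ j → f≗false (suc j))

countTrue-subadditive : ∀ {d} (f g h : Fin d → Bool) →
  (∀ j → indicator (f j) ≤ indicator (g j) + indicator (h j)) →
  countTrue f ≤ countTrue g + countTrue h
countTrue-subadditive {zero} f g h le = z≤n
countTrue-subadditive {suc d} f g h le = ≤-trans
  (+-mono-≤ (le zero) (countTrue-subadditive (λ j → f (suc j)) (λ j → g (suc j)) (λ j → h (suc j)) (λ j → le (suc j))))
  (≤-reflexive (interchange (indicator (g zero)) (indicator (h zero)) _ _))

clear : ∀ {d} → (Fin d → Bool) → Fin d → Fin d → Bool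
clear f i j = if does (i ≟ j) then false else f j

countTrue-clear : ∀ {d} (f : Fin d → Bool) i → f i ≡ true → countTrue f ≡ suc (countTrue (clear f i))
countTrue-clear f zero fi≡true rewrite fi≡true = refl
countTrue-clear {suc d} f (suc i) fi≡true with f zero
... | true = cong suc (countTrue-clear (λ j → f (suc j)) i fi≡true)
... | false = countTrue-clear (λ j → f (suc j)) i fi≡true

countTrue-suc⇒true : ∀ {d} (f : Fin d → Bool) {m} → countTrue f ≡ suc m → Σ (Fin d) (λ i → f i ≡ true)
countTrue-suc⇒true {suc d} f eq with f zero in f0
... | true = zero , f0
... | false with countTrue-suc⇒true (λ j → f (suc j)) eq
...   | i , fi = suc i , fi

countTrue-suc : ∀ {d} (f : Fin d → Bool) {m} → countTrue f ≡ suc m →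
  Σ (Fin d) (λ i → f i ≡ true × countTrue (clear f i) ≡ m)
countTrue-suc f eq with countTrue-suc⇒true f eq
... | i , fi = i , fi , suc-injective (trans (sym (countTrue-clear f i fi)) eq)

differ : Bool → Bool → Bool
differ a b = not (does (a Bool.≟ b))

differ-refl : ∀ a → differ a a ≡ false
differ-refl false = refl
differ-refl true = refl

differ-sym : ∀ a b → differ a b ≡ differ b a
differ-sym false false = refl
differ-sym false true = refl
differ-sym true false = refl
differ-sym true true = refl

differ-not : ∀ a → differ a (not a) ≡ true
differ-not false = refl
differ-not true = refl

differ-notˡ : ∀ a b → differ a b ≡ true → differ (not a) b ≡ false
differ-notˡ false true _ = refl
differ-notˡ true false _ = refl

differ-triangle : ∀ a b c → indicator (differ a c) ≤ indicator (differ a b) + indicator (differ b c)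
differ-triangle false false c = ≤-refl
differ-triangle false true false = z≤n
differ-triangle false true true = s≤s z≤n
differ-triangle true false false = s≤s z≤n
differ-triangle true false true = z≤n
differ-triangle true true c = ≤-refl

dist-refl : ∀ {d} (x : Vertex d) → dist x x ≡ 0
dist-refl x = countTrue-false (λ j → differ-refl (x j))

dist-sym : ∀ {d} (x y : Vertex d) → dist x y ≡ dist y x
dist-sym x y = countTrue-cong (λ j → differ-sym (x j) (y j))

dist-triangle : ∀ {d} (x y z : Vertex d) → dist x z ≤ dist x y + dist y z
dist-triangle x y z = countTrue-subadditive _ _ _ (λ j → differ-triangle (x j) (y j) (z j))

dist-flip : ∀ {d} (x : Vertex d) i → dist x (flip x i) ≡ 1
dist-flip x i = trans
  (countTrue-clear (λ j → differ (x j) (flip x i j)) i differs-at-i)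
  (cong suc (countTrue-false agrees-off-i))
  where
  differs-at-i : differ (x i) (flip x i i) ≡ true
  differs-at-i with i ≟ i
  ... | yes _ = differ-not (x i)
  ... | no i≢i = ⊥-elim (i≢i refl)
  agrees-off-i : ∀ j → clear (λ j → differ (x j) (flip x i j)) i j ≡ false
  agrees-off-i j with i ≟ j
  ... | yes _ = refl
  ... | no _ = differ-refl (x j)

dist-suc⇒closer-flip : ∀ {d} (x v : Vertex d) {m} → dist x v ≡ suc m → Σ (Fin d) (λ i → dist (flip x i) v ≡ m)
dist-suc⇒closer-flip x v eq with countTrue-suc (λ j → differ (x j) (v j)) eq
... | i , differs-at-i , count≡m = i , trans (countTrue-cong flip≗clear) count≡m
  where
  flip≗clear : ∀ j → differ (flip x i j) (v j) ≡ clear (λ j → differ (x j) (v j)) i j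
  flip≗clear j with i ≟ j
  ... | yes refl = differ-notˡ (x i) (v i) differs-at-i
  ... | no _ = refl

Path-trans : ∀ {d} {Q' : Subgraph d} {u v w} → Path Q' u v → Path Q' v w → Path Q' u w
Path-trans here q = q
Path-trans (step i kept p) q = step i kept (Path-trans p q)

module _ {d} (Q' : Subgraph d) (G : Vertex d → Set)
         (near-G : ∀ x → Σ (Fin d) (λ i → G (flip x i)))
         (locally-connected : ∀ u v → G u → G v → dist u v ≤ 3 → Path Q' u v) where

  open ≤-Reasoning

  connected-from-near : ∀ n {v} x g → G g → G v → dist g x ≤ 1 → dist x v ≡ n → Path Q' g v
  connected-from-near zero {v} x g Gg Gv g~x x≡v = locally-connected g v Gg Gv (begin
    dist g v             ≤⟨ dist-triangle g x v ⟩
    dist g x + dist x v  ≡⟨ cong (dist g x +_) x≡v ⟩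
    dist g x + 0         ≡⟨ +-identityʳ (dist g x) ⟩
    dist g x             ≤⟨ ≤-trans g~x (s≤s z≤n) ⟩
    3                    ∎)
  connected-from-near (suc n) {v} x g Gg Gv g~x x~v with dist-suc⇒closer-flip x v x~v
  ... | i , x′~v with near-G (flip x i)
  ...   | j , Gg′ = Path-trans
          (locally-connected g g′ Gg Gg′ g~g′)
          (connected-from-near n x′ g′ Gg′ Gv g′~x′ x′~v)
    where
    x′ = flip x i
    g′ = flip x′ j
    g′~x′ : dist g′ x′ ≤ 1
    g′~x′ = ≤-reflexive (trans (dist-sym g′ x′) (dist-flip x′ j))
    g~g′ : dist g g′ ≤ 3
    g~g′ = begin
      dist g g′                           ≤⟨ dist-triangle g x g′ ⟩
      dist g x + dist x g′                ≤⟨ +-monoʳ-≤ (dist g x) (dist-triangle x x′ g′) ⟩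
      dist g x + (dist x x′ + dist x′ g′) ≤⟨ +-mono-≤ g~x (+-mono-≤ (≤-reflexive (dist-flip x i)) (≤-reflexive (dist-flip x′ j))) ⟩
      3                                   ∎

  connected : ∀ u v → G u → G v → Path Q' u v
  connected u v Gu Gv = connected-from-near (dist u v) u u Gu Gv (≤-trans (≤-reflexive (dist-refl u)) z≤n) refl

lemma8 : (p : ℚ) → 0ℚ < p → p < ½ → (d : ℕ) → (Q' : Subgraph d)
    → (∀ (x : Vertex d) → Σ (Fin d) (λ i → Good p Q' (flip x i)))
    → (∀ (u v : Vertex d) → Good p Q' u → Good p Q' v → dist u v ≤ 3 → Path Q' u v)
    → ∀ (u v : Vertex d) → Good p Q' u → Good p Q' v → Path Q' u v
lemma8 p _ _ d Q' = connected Q' (Good p Q')
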